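{- Let $N\ge0$, let $\mathcal S\subseteq\Omega_N\cup\{V\}$ with $U_N\in\mathcal S$, and $\mathcal V=\mathcal S\cup\{V\}$. Then $$D_{\mathcal V}=\left(\frac{1}{1-y},\ \frac{y}{1-y}\sum_{S_k\in\mathcal V}y^{N-k}\right)$$ is a proper Riordan array, and its $(i,j)$th entry $d_{i,j}$ ($i,j\ge0$) equals the number of free $\mathcal V$-paths from $(0,0)$ to $(j,(N+1)j-i)$, i.e. $d_{i,j}=|\mathcal F_{\mathcal V}(i-(N+1)j,j)|$.
   Context: Steps: $V=(0,-1)$ and $S_k=(1,k)$ for $k\in\mathbb Z$; $U_k=S_k$ for $k\ge0$. $\Omega_N=\{S_k:k\le N\}$. For a set of steps $\mathcal S$, an $\mathcal S$-path is a finite sequence of steps from $\mathcal S$ starting at $(0,0)$; $\mathcal F_{\mathcal S}(m,n)$ is the set of $\mathcal S$-paths ending at $(n,-m)$ (free paths). A proper Riordan array is a pair $(g,f)$ of formal power series $g(y)=\sum_{n\ge0}g_ny^n$ with $g_0\ne0$ and $f(y)=\sum_{n\ge1}f_ny^n$ with $f_1\ne0$; the associated infinite matrix has $(i,j)$th entry $[y^i]g(y)f(y)^j$. The sum $\sum_{S_k\in\mathcal V}$ ranges over non-vertical steps of $\mathcal V$. -}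

module Defs where

open import Data.Nat using (ℕ; zero; suc; _+_; _*_; _∸_)
open import Data.Integer as ℤ using (ℤ; +_)
open import Data.Bool using (Bool; true; false; _∨_; if_then_else_)
open import Data.List using (List; []; _∷_; map; upTo)
open import Data.Nat.ListAction using (sum)
open import Data.List.Relation.Unary.All using (All)
open import Data.Product using (Σ; _×_; _,_)
open import Relation.Binary.PropositionalEquality using (_≡_)
open import Data.Bool using (T)

data Step : Set where
  V : Step
  S : ℤ → Step

isV : Step → Bool
isV V     = true
isV (S _) = false

StepSet : Set
StepSet = Step → Bool

addV : StepSet → StepSet
addV 𝒮 s = 𝒮 s ∨ isV s

disp : Step → ℤ × ℤ
disp V     = (+ 0 , ℤ.- (+ 1))
disp (S k) = (+ 1 , k)

endpoint : List Step → ℤ × ℤ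
endpoint []      = (+ 0 , + 0)
endpoint (s ∷ p) with disp s | endpoint p
... | (a , b) | (c , d) = (a ℤ.+ c , b ℤ.+ d)

FreePaths : StepSet → ℤ → ℤ → Set
FreePaths 𝒮 m n =
  Σ (List Step) λ p → All (λ s → T (𝒮 s)) p × (endpoint p ≡ (n , ℤ.- m))

-- Formal power series with ℕ coefficients: n ↦ [y^n]
PS : Set
PS = ℕ → ℕ

_⋆_ : PS → PS → PS
(a ⋆ b) n = sum (map (λ k → a k * b (n ∸ k)) (upTo (suc n)))

_^ps_ : PS → ℕ → PS
f ^ps zero  = λ n → if Data.Nat._≡ᵇ_ n 0 then 1 else 0
f ^ps suc j = f ⋆ (f ^ps j)

riordanEntry : PS → PS → ℕ → ℕ → ℕ
riordanEntry g f i j = (g ⋆ (f ^ps j)) i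

ProperRiordan : PS → PS → Set
ProperRiordan g f = ¬ (g 0 ≡ 0) × (f 0 ≡ 0) × ¬ (f 1 ≡ 0)
  where open import Relation.Nullary using (¬_)

geom : PS
geom _ = 1

ygeom : PS
ygeom zero    = 0
ygeom (suc _) = 1

-- Σ_{S_k ∈ 𝒱} y^{N-k}: coefficient of y^m is 1 iff S_{N-m} ∈ 𝒱
stepSeries : ℕ → StepSet → PS
stepSeries N 𝒱 m = if 𝒱 (S ((+ N) ℤ.- (+ m))) then 1 else 0

Dg : PS
Dg = geom

Df : ℕ → StepSet → PS
Df N 𝒱 = ygeom ⋆ stepSeries N 𝒱

-- Weigh V by 1 and S_k by 1 + (N − k), which is ≥ 1 for every non-vertical step of 𝒱.  A path
-- with j non-vertical steps and weight w ends at (j, (N+1)j − w), so d_{i,j} should count the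
-- 𝒱-paths with j non-vertical steps and weight i.  Such a path factors uniquely as
-- V^a S_{k₁} V^{a₁} ⋯ S_{k_j} V^{a_j}, whose weight generating function is
-- 1/(1−y) · (y/(1−y) · Σ y^{N−k})^j = g f^j.  Reading each Cauchy product as the type of ways of
-- splitting the index turns this factorisation into the required bijections.
module Submission where

open import Defs
open import Data.Nat using (ℕ; _*_; suc)
open import Data.Integer as ℤ using (ℤ; +_; _≤_; _-_)
open import Data.Bool using (T)
open import Data.Fin using (Fin)
open import Data.Product using (_×_)
open import Function.Bundles using (_↔_)

open import Axiom.UniquenessOfIdentityProofs.WithK using (uip)
open import Data.Bool using (true; false; if_then_else_)
open import Data.Bool.Properties using (T-irrelevant; ∨-identityʳ; ∨-zeroʳ)
open import Data.Empty using (⊥)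
import Data.Fin.Properties as Fin
import Data.Integer.Properties as ℤ
import Data.Integer.Tactic.RingSolver as ℤ-Solver
open import Data.List using (List; []; _∷_; _++_; replicate)
open import Data.List.Properties using (∷-injective; ∷-injectiveʳ; map-applyUpTo; map-upTo)
open import Data.List.Relation.Unary.All as All using (All; []; _∷_)
open import Data.List.Relation.Unary.All.Properties using (++⁺; replicate⁺)
open import Data.Nat using (zero; _+_; _∸_; pred)
open import Data.Nat.ListAction using (sum)
import Data.Nat.Properties as ℕ
import Data.Nat.Tactic.RingSolver as ℕ-Solver
open import Data.Product using (Σ; _,_; proj₁; proj₂; map₁)
open import Data.Product.Function.NonDependent.Propositional using (_×-↔_)
open import Data.Product.Properties using (,-injectiveˡ; ,-injectiveʳ)
open import Data.Sum using (_⊎_; inj₁; inj₂)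
open import Data.Sum.Function.Propositional using (_⊎-↔_)
open import Data.Unit using (⊤; tt)
open import Function using (_∘_)
open import Function.Bundles using (mk↔ₛ′)
open import Function.Properties.Inverse using (↔-trans)
open import Function.Related.Propositional using (module EquationalReasoning; bijection)
open import Relation.Nullary using (¬_)
open import Relation.Binary.PropositionalEquality

Convolution : (ℕ → Set) → (ℕ → Set) → ℕ → Set
Convolution A B n = Σ ℕ λ k → Σ ℕ λ l → k + l ≡ n × A k × B l

Convolution-≡ : ∀ {A B : ℕ → Set} {n k l} {e e′ : k + l ≡ n} {x x′ : A k} {y y′ : B l} →
                x ≡ x′ → y ≡ y′ →
                _≡_ {A = Convolution A B n} (k , l , e , x , y) (k , l , e′ , x′ , y′)
Convolution-≡ {e = e} {e′} refl refl = cong (λ e → _ , _ , e , _ , _) (uip e e′)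

module _ {A B : ℕ → Set} where

  Convolution-zero↔ : Convolution A B 0 ↔ (A 0 × B 0)
  Convolution-zero↔ = mk↔ₛ′ to (λ xy → 0 , 0 , refl , xy) (λ _ → refl) from∘to
    where
    to : Convolution A B 0 → A 0 × B 0
    to (0 , 0 , refl , xy) = xy
    from∘to : ∀ c → (0 , 0 , refl , to c) ≡ c
    from∘to (0 , 0 , refl , _) = refl

  Convolution-suc↔ : ∀ {n} →
    Convolution A B (suc n) ↔ ((A 0 × B (suc n)) ⊎ Convolution (A ∘ suc) B n)
  Convolution-suc↔ = mk↔ₛ′ to from to∘from from∘to
    where
    to : ∀ {n} → Convolution A B (suc n) → (A 0 × B (suc n)) ⊎ Convolution (A ∘ suc) B n
    to (zero  , _ , refl , xy)    = inj₁ xy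
    to (suc k , l , refl , x , y) = inj₂ (k , l , refl , x , y)
    from : ∀ {n} → (A 0 × B (suc n)) ⊎ Convolution (A ∘ suc) B n → Convolution A B (suc n)
    from (inj₁ xy)                 = 0 , _ , refl , xy
    from (inj₂ (k , l , e , x , y)) = suc k , l , cong suc e , x , y
    to∘from : ∀ {n} (z : (A 0 × B (suc n)) ⊎ Convolution (A ∘ suc) B n) → to (from z) ≡ z
    to∘from (inj₁ _)                    = refl
    to∘from (inj₂ (k , l , refl , _ , _)) = refl
    from∘to : ∀ {n} (c : Convolution A B (suc n)) → from (to c) ≡ c
    from∘to (zero  , _ , refl , _) = refl
    from∘to (suc k , _ , refl , _) = refl

⋆-zero : ∀ a b → (a ⋆ b) 0 ≡ a 0 * b 0
⋆-zero a b = ℕ.+-identityʳ (a 0 * b 0)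

⋆-suc : ∀ a b n → (a ⋆ b) (suc n) ≡ a 0 * b (suc n) + ((a ∘ suc) ⋆ b) n
⋆-suc a b n = cong (λ xs → a 0 * b (suc n) + sum xs)
  (trans (map-applyUpTo suc (λ k → a k * b (suc n ∸ k)) (suc n))
         (sym (map-upTo (λ k → a (suc k) * b (n ∸ k)) (suc n))))

Fin-⋆↔Convolution : ∀ {a b : PS} {A B : ℕ → Set} →
                    (∀ k → Fin (a k) ↔ A k) → (∀ k → Fin (b k) ↔ B k) → ∀ n → Fin ((a ⋆ b) n) ↔ Convolution A B n
Fin-⋆↔Convolution {a} {b} {A} {B} a↔A b↔B zero = begin
  Fin ((a ⋆ b) 0)        ≡⟨ cong Fin (⋆-zero a b) ⟩
  Fin (a 0 * b 0)        ↔⟨ Fin.*↔× ⟩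
  (Fin (a 0) × Fin (b 0)) ↔⟨ a↔A 0 ×-↔ b↔B 0 ⟩
  (A 0 × B 0)            ↔⟨ Convolution-zero↔ ⟨
  Convolution A B 0      ∎
  where open EquationalReasoning {bijection}
Fin-⋆↔Convolution {a} {b} {A} {B} a↔A b↔B (suc n) = begin
  Fin ((a ⋆ b) (suc n))                              ≡⟨ cong Fin (⋆-suc a b n) ⟩
  Fin (a 0 * b (suc n) + ((a ∘ suc) ⋆ b) n)          ↔⟨ Fin.+↔⊎ ⟩
  (Fin (a 0 * b (suc n)) ⊎ Fin (((a ∘ suc) ⋆ b) n))  ↔⟨ head ⊎-↔ Fin-⋆↔Convolution (a↔A ∘ suc) b↔B n ⟩
  ((A 0 × B (suc n)) ⊎ Convolution (A ∘ suc) B n)    ↔⟨ Convolution-suc↔ ⟨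
  Convolution A B (suc n)                            ∎
  where
  open EquationalReasoning {bijection}
  head : Fin (a 0 * b (suc n)) ↔ (A 0 × B (suc n))
  head = ↔-trans Fin.*↔× (a↔A 0 ×-↔ b↔B (suc n))

IsZero : ℕ → Set
IsZero zero    = ⊤
IsZero (suc _) = ⊥

IsSuc : ℕ → Set
IsSuc zero    = ⊥
IsSuc (suc _) = ⊤

Fin-if↔T : ∀ b → Fin (if b then 1 else 0) ↔ T b
Fin-if↔T true  = Fin.1↔⊤
Fin-if↔T false = Fin.0↔⊥

Fin-ygeom↔IsSuc : ∀ k → Fin (ygeom k) ↔ IsSuc k
Fin-ygeom↔IsSuc zero    = Fin.0↔⊥
Fin-ygeom↔IsSuc (suc _) = Fin.1↔⊤

Fin-^ps-zero↔IsZero : ∀ f k → Fin ((f ^ps 0) k) ↔ IsZero k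
Fin-^ps-zero↔IsZero _ zero    = Fin.1↔⊤
Fin-^ps-zero↔IsZero _ (suc _) = Fin.0↔⊥

Df-proper : ∀ N 𝒱 → T (𝒱 (S (+ N))) → ProperRiordan Dg (Df N 𝒱)
Df-proper N 𝒱 S_N∈𝒱 = (λ ()) , refl , Df-one≢0
  where
  Df-one≢0 : ¬ Df N 𝒱 1 ≡ 0
  -- Df N 𝒱 1 computes to the indicator of S (+ N - + 0) ∈ 𝒱.
  Df-one≢0 with 𝒱 (S (+ N - + 0)) | subst (T ∘ 𝒱 ∘ S) (sym (ℤ.+-identityʳ (+ N))) S_N∈𝒱
  ... | true | _ = λ ()

i-[i-j]≡j : ∀ i j → i - (i - j) ≡ j
i-[i-j]≡j = ℤ-Solver.solve-∀

i-m≡i-n⇒m≡n : ∀ i {m n} → i - + m ≡ i - + n → m ≡ n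
i-m≡i-n⇒m≡n i {m} {n} eq = ℤ.+-injective (begin
  + m            ≡⟨ i-[i-j]≡j i (+ m) ⟨
  i - (i - + m)  ≡⟨ cong (i -_) eq ⟩
  i - (i - + n)  ≡⟨ i-[i-j]≡j i (+ n) ⟩
  + n            ∎)
  where open ≡-Reasoning

1+a+m+w≡1+m+[a+w] : ∀ a m w → suc a + m + w ≡ suc m + (a + w)
1+a+m+w≡1+m+[a+w] = ℕ-Solver.solve-∀

module WeightedPaths (N : ℕ) (𝒱 : StepSet)
  (V∈𝒱 : T (𝒱 V)) (S∈𝒱⇒≤N : ∀ {k} → T (𝒱 (S k)) → k ≤ + N) where

  Allowed : Step → Set
  Allowed s = T (𝒱 s)

  -- S_k contributes y^{gap k} to the step series.
  gap : ℤ → ℕ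
  gap k = ℤ.∣ k - + N ∣

  N-gap[k]≡k : ∀ {k} → k ≤ + N → + N - + gap k ≡ k
  N-gap[k]≡k {k} k≤N = trans (cong (+ N -_) (ℤ.∣-∣-≤ k≤N)) (i-[i-j]≡j (+ N) k)

  gap[N-m]≡m : ∀ m → gap (+ N - + m) ≡ m
  gap[N-m]≡m m = i-m≡i-n⇒m≡n (+ N) (N-gap[k]≡k (ℤ.i-j≤i (+ N) (+ m)))

  AllowedGap : ℕ → Set
  AllowedGap m = Allowed (S (+ N - + m))

  width : List Step → ℕ
  width []        = 0
  width (V ∷ p)   = width p
  width (S _ ∷ p) = suc (width p)

  weight : List Step → ℕ
  weight []        = 0
  weight (V ∷ p)   = suc (weight p)
  weight (S k ∷ p) = suc (gap k) + weight p

  WeightedPath : ℕ → ℕ → Set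
  WeightedPath j w = Σ (List Step) λ p → All Allowed p × width p ≡ j × weight p ≡ w

  WeightedPath-≡ : ∀ {j w} {x y : WeightedPath j w} → proj₁ x ≡ proj₁ y → x ≡ y
  WeightedPath-≡ {x = p , v , e , f} {.p , v′ , e′ , f′} refl
    rewrite All.irrelevant T-irrelevant v v′ | uip e e′ | uip f f′ = refl

  -- A block S_{N−m} V^{l−1} of weight l + m, counted by y/(1−y) · Σ y^{N−k}.
  Block : ℕ → Set
  Block = Convolution IsSuc AllowedGap

  -- Paths of a given width and weight that are empty or start with a non-vertical step.
  Tail : ℕ → ℕ → Set
  Tail zero    = IsZero
  Tail (suc j) = Convolution Block (Tail j)

  Factorisation : ℕ → ℕ → Set
  Factorisation j = Convolution (λ _ → ⊤) (Tail j)

  Fin-Df↔Block : ∀ k → Fin (Df N 𝒱 k) ↔ Block k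
  Fin-Df↔Block = Fin-⋆↔Convolution Fin-ygeom↔IsSuc (λ m → Fin-if↔T (𝒱 (S (+ N - + m))))

  Fin-Df^↔Tail : ∀ j k → Fin ((Df N 𝒱 ^ps j) k) ↔ Tail j k
  Fin-Df^↔Tail zero    = Fin-^ps-zero↔IsZero (Df N 𝒱)
  Fin-Df^↔Tail (suc j) = Fin-⋆↔Convolution Fin-Df↔Block (Fin-Df^↔Tail j)

  Fin-entry↔Factorisation : ∀ i j → Fin (riordanEntry Dg (Df N 𝒱) i j) ↔ Factorisation j i
  Fin-entry↔Factorisation i j = Fin-⋆↔Convolution (λ _ → Fin.1↔⊤) (Fin-Df^↔Tail j) i

  renderTail : ∀ j {w} → Tail j w → List Step
  renderTail zero    _                                    = []
  renderTail (suc j) (_ , _ , _ , (l , m , _ , _ , _) , t) =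
    S (+ N - + m) ∷ replicate (pred l) V ++ renderTail j t

  render : ∀ j {i} → Factorisation j i → List Step
  render j (a , _ , _ , _ , t) = replicate a V ++ renderTail j t

  width-replicateV-++ : ∀ a p → width (replicate a V ++ p) ≡ width p
  width-replicateV-++ zero    p = refl
  width-replicateV-++ (suc a) p = width-replicateV-++ a p

  weight-replicateV-++ : ∀ a p → weight (replicate a V ++ p) ≡ a + weight p
  weight-replicateV-++ zero    p = refl
  weight-replicateV-++ (suc a) p = cong suc (weight-replicateV-++ a p)

  renderTail-allowed : ∀ j {w} (t : Tail j w) → All Allowed (renderTail j t)
  renderTail-allowed zero    _ = []
  renderTail-allowed (suc j) (_ , _ , _ , (l , _ , _ , _ , s) , t) =
    s ∷ ++⁺ (replicate⁺ (pred l) V∈𝒱) (renderTail-allowed j t)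

  renderTail-width : ∀ j {w} (t : Tail j w) → width (renderTail j t) ≡ j
  renderTail-width zero    _ = refl
  renderTail-width (suc j) (_ , _ , _ , (l , _ , _ , _ , _) , t) =
    cong suc (trans (width-replicateV-++ (pred l) _) (renderTail-width j t))

  renderTail-weight : ∀ j {w} (t : Tail j w) → weight (renderTail j t) ≡ w
  renderTail-weight zero    {zero} _ = refl
  renderTail-weight (suc j) (_ , w , refl , (suc a , m , refl , _ , _) , t) = begin
    suc (gap (+ N - + m)) + weight (replicate a V ++ renderTail j t)
      ≡⟨ cong₂ (λ g r → suc g + r) (gap[N-m]≡m m) (weight-replicateV-++ a _) ⟩
    suc m + (a + weight (renderTail j t))
      ≡⟨ cong (λ r → suc m + (a + r)) (renderTail-weight j t) ⟩
    suc m + (a + w)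
      ≡⟨ 1+a+m+w≡1+m+[a+w] a m w ⟨
    suc a + m + w
      ∎
    where open ≡-Reasoning

  toWeightedPath : ∀ j {i} → Factorisation j i → WeightedPath j i
  toWeightedPath j c@(a , _ , e , _ , t) =
    render j c ,
    ++⁺ (replicate⁺ a V∈𝒱) (renderTail-allowed j t) ,
    trans (width-replicateV-++ a _) (renderTail-width j t) ,
    trans (weight-replicateV-++ a _) (trans (cong (λ r → a + r) (renderTail-weight j t)) e)

  prependV : ∀ {j i} → Factorisation j i → Factorisation j (suc i)
  prependV (a , w , e , _ , t) = suc a , w , cong suc e , tt , t

  prependS : ∀ {j i} m → AllowedGap m → Factorisation j i → Factorisation (suc j) (suc m + i)
  prependS m s (a , w , e , _ , t) =
    0 , _ , refl , tt ,
    suc a + m , w , trans (1+a+m+w≡1+m+[a+w] a m w) (cong (λ r → suc m + r) e) ,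
    (suc a , m , refl , tt , s) , t

  factorise : (p : List Step) → All Allowed p → Factorisation (width p) (weight p)
  factorise []        []           = 0 , 0 , refl , tt , tt
  factorise (V ∷ p)   (_ ∷ v)      = prependV {width p} (factorise p v)
  factorise (S k ∷ p) (k∈𝒱 ∷ v) =
    prependS {width p} (gap k) (subst (Allowed ∘ S) (sym (N-gap[k]≡k (S∈𝒱⇒≤N k∈𝒱))) k∈𝒱)
             (factorise p v)

  render-factorise : ∀ p v → render (width p) (factorise p v) ≡ p
  render-factorise []        []           = refl
  render-factorise (V ∷ p)   (_ ∷ v)      = cong (V ∷_) (render-factorise p v)
  render-factorise (S k ∷ p) (k∈𝒱 ∷ v) =
    cong₂ _∷_ (cong S (N-gap[k]≡k (S∈𝒱⇒≤N k∈𝒱))) (render-factorise p v)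

  fromWeightedPath : ∀ {j i} → WeightedPath j i → Factorisation j i
  fromWeightedPath (p , v , refl , refl) = factorise p v

  render-fromWeightedPath : ∀ {j i} (x : WeightedPath j i) → render j (fromWeightedPath x) ≡ proj₁ x
  render-fromWeightedPath (p , v , refl , refl) = render-factorise p v

  HeadNotV : List Step → Set
  HeadNotV (V ∷ _) = ⊥
  HeadNotV _       = ⊤

  renderTail-headNotV : ∀ j {w} (t : Tail j w) → HeadNotV (renderTail j t)
  renderTail-headNotV zero    _ = tt
  renderTail-headNotV (suc j) _ = tt

  replicateV-++-injective : ∀ a a′ {r r′} → HeadNotV r → HeadNotV r′ →
                            replicate a V ++ r ≡ replicate a′ V ++ r′ → a ≡ a′ × r ≡ r′
  replicateV-++-injective zero    zero     _  _  eq   = refl , eq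
  replicateV-++-injective zero    (suc a′) () _  refl
  replicateV-++-injective (suc a) zero     _  () refl
  replicateV-++-injective (suc a) (suc a′) h  h′ eq   =
    map₁ (cong suc) (replicateV-++-injective a a′ h h′ (∷-injectiveʳ eq))

  S-injective : ∀ {k k′} → S k ≡ S k′ → k ≡ k′
  S-injective refl = refl

  renderTail-injective : ∀ j {w} (t t′ : Tail j w) → renderTail j t ≡ renderTail j t′ → t ≡ t′
  renderTail-injective zero {zero} _ _ _ = refl
  renderTail-injective (suc j) (_ , w₁ , e , (suc a , m , refl , _ , s) , t)
                               (_ , w₁′ , e′ , (suc a′ , m′ , refl , _ , s′) , t′) eq
    with ∷-injective eq
  ... | head≡ , rest≡ with i-m≡i-n⇒m≡n (+ N) {m} {m′} (S-injective head≡)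
  ... | refl with replicateV-++-injective a a′ (renderTail-headNotV j t) (renderTail-headNotV j t′) rest≡
  ... | refl , tail≡ with ℕ.+-cancelˡ-≡ (suc a + m) w₁ w₁′ (trans e (sym e′))
  ... | refl = Convolution-≡ (Convolution-≡ refl (T-irrelevant s s′)) (renderTail-injective j t t′ tail≡)

  render-injective : ∀ j {i} (c c′ : Factorisation j i) → render j c ≡ render j c′ → c ≡ c′
  render-injective j (a , w , e , _ , t) (a′ , w′ , e′ , _ , t′) eq
    with replicateV-++-injective a a′ (renderTail-headNotV j t) (renderTail-headNotV j t′) eq
  ... | refl , tail≡ with ℕ.+-cancelˡ-≡ a w w′ (trans e (sym e′))
  ... | refl = Convolution-≡ refl (renderTail-injective j t t′ tail≡)

  Factorisation↔WeightedPath : ∀ j i → Factorisation j i ↔ WeightedPath j i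
  Factorisation↔WeightedPath j i = mk↔ₛ′ (toWeightedPath j) fromWeightedPath
    (λ x → WeightedPath-≡ (render-fromWeightedPath x))
    (λ c → render-injective j _ c (render-fromWeightedPath (toWeightedPath j c)))

  height : ℕ → ℕ → ℤ
  height j w = + suc N ℤ.* + j - + w

  height-V : ∀ j w → ℤ.- (+ 1) ℤ.+ height j w ≡ height j (suc w)
  height-V j w = identity (+ suc N ℤ.* + j) (+ w)
    where
    identity : ∀ x w → ℤ.- (+ 1) ℤ.+ (x - w) ≡ x - (+ 1 ℤ.+ w)
    identity = ℤ-Solver.solve-∀

  height-S : ∀ {k} → k ≤ + N → ∀ j w → k ℤ.+ height j w ≡ height (suc j) (suc (gap k) + w)
  height-S {k} k≤N j w = begin
    k ℤ.+ height j w                                    ≡⟨ identity k (+ N) (+ j) (+ w) ⟩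
    + suc N ℤ.* + suc j - (+ 1 ℤ.+ (+ N - k) ℤ.+ + w)   ≡⟨ cong (λ g → + suc N ℤ.* + suc j - (+ 1 ℤ.+ g ℤ.+ + w))
                                                                 (ℤ.∣-∣-≤ k≤N) ⟨
    height (suc j) (suc (gap k) + w)                    ∎
    where
    open ≡-Reasoning
    identity : ∀ k n j w →
               k ℤ.+ ((+ 1 ℤ.+ n) ℤ.* j - w) ≡ (+ 1 ℤ.+ n) ℤ.* (+ 1 ℤ.+ j) - (+ 1 ℤ.+ (n - k) ℤ.+ w)
    identity = ℤ-Solver.solve-∀

  endpoint-allowed : ∀ p → All Allowed p → endpoint p ≡ (+ width p , height (width p) (weight p))
  endpoint-allowed []        []           =
    cong (+ 0 ,_) (sym (trans (ℤ.+-identityʳ _) (ℤ.*-zeroʳ (+ suc N))))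
  endpoint-allowed (V ∷ p)   (_ ∷ v)      =
    trans (cong (λ q → + 0 ℤ.+ proj₁ q , ℤ.- (+ 1) ℤ.+ proj₂ q) (endpoint-allowed p v))
          (cong (+ width p ,_) (height-V (width p) (weight p)))
  endpoint-allowed (S k ∷ p) (k∈𝒱 ∷ v) =
    trans (cong (λ q → + 1 ℤ.+ proj₁ q , k ℤ.+ proj₂ q) (endpoint-allowed p v))
          (cong (+ suc (width p) ,_) (height-S (S∈𝒱⇒≤N k∈𝒱) (width p) (weight p)))

  height-target : ∀ i j → ℤ.- (+ i - + (suc N * j)) ≡ height j i
  height-target i j = trans (identity (+ i) (+ (suc N * j))) (cong (_- + i) (ℤ.pos-* (suc N) j))
    where
    identity : ∀ i x → ℤ.- (i - x) ≡ x - i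
    identity = ℤ-Solver.solve-∀

  WeightedPath↔FreePaths : ∀ i j → WeightedPath j i ↔ FreePaths 𝒱 (+ i - + (suc N * j)) (+ j)
  WeightedPath↔FreePaths i j =
    mk↔ₛ′ to from (λ (p , v , e) → cong (λ e′ → p , v , e′) (uip _ e)) (λ _ → WeightedPath-≡ refl)
    where
    to : WeightedPath j i → FreePaths 𝒱 (+ i - + (suc N * j)) (+ j)
    to (p , v , width≡ , weight≡) =
      p , v , trans (endpoint-allowed p v)
                    (trans (cong₂ (λ j′ w → + j′ , height j′ w) width≡ weight≡)
                           (cong (+ j ,_) (sym (height-target i j))))
    from : FreePaths 𝒱 (+ i - + (suc N * j)) (+ j) → WeightedPath j i
    from (p , v , e) = p , v , width≡ , weight≡
      where
      endpoints≡ : (+ width p , height (width p) (weight p)) ≡ (+ j , ℤ.- (+ i - + (suc N * j)))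
      endpoints≡ = trans (sym (endpoint-allowed p v)) e
      width≡ : width p ≡ j
      width≡ = ℤ.+-injective (,-injectiveˡ endpoints≡)
      weight≡ : weight p ≡ i
      weight≡ = i-m≡i-n⇒m≡n (+ suc N ℤ.* + j) (begin
        height j (weight p)             ≡⟨ cong (λ j′ → height j′ (weight p)) width≡ ⟨
        height (width p) (weight p)     ≡⟨ ,-injectiveʳ endpoints≡ ⟩
        ℤ.- (+ i - + (suc N * j))       ≡⟨ height-target i j ⟩
        height j i                      ∎)
        where open ≡-Reasoning

  Fin-entry↔FreePaths : ∀ i j →
    Fin (riordanEntry Dg (Df N 𝒱) i j) ↔ FreePaths 𝒱 (+ i - + (suc N * j)) (+ j)
  Fin-entry↔FreePaths i j = begin
    Fin (riordanEntry Dg (Df N 𝒱) i j)         ↔⟨ Fin-entry↔Factorisation i j ⟩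
    Factorisation j i                           ↔⟨ Factorisation↔WeightedPath j i ⟩
    WeightedPath j i                            ↔⟨ WeightedPath↔FreePaths i j ⟩
    FreePaths 𝒱 (+ i - + (suc N * j)) (+ j)     ∎
    where open EquationalReasoning {bijection}

V∈addV : ∀ 𝒮 → T (addV 𝒮 V)
V∈addV 𝒮 = subst T (sym (∨-zeroʳ (𝒮 V))) tt

addV-S : ∀ 𝒮 k → addV 𝒮 (S k) ≡ 𝒮 (S k)
addV-S 𝒮 k = ∨-identityʳ (𝒮 (S k))

mainTheorem13 : (N : ℕ) (𝒮 : StepSet)
    → (∀ k → T (𝒮 (S k)) → k ≤ + N)
    → T (𝒮 (S (+ N)))
    → ProperRiordan Dg (Df N (addV 𝒮))
      × (∀ (i j : ℕ) → Fin (riordanEntry Dg (Df N (addV 𝒮)) i j)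
          ↔ FreePaths (addV 𝒮) (+ i - + (suc N * j)) (+ j))
mainTheorem13 N 𝒮 S∈𝒮⇒≤N S_N∈𝒮 =
  Df-proper N (addV 𝒮) (subst T (sym (addV-S 𝒮 (+ N))) S_N∈𝒮) , Fin-entry↔FreePaths
  where
  open WeightedPaths N (addV 𝒮) (V∈addV 𝒮)
                     (λ {k} k∈𝒱 → S∈𝒮⇒≤N k (subst T (addV-S 𝒮 k) k∈𝒱))
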